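{- Let $n\ge 3$ and let $P(G(n))$ be the power graph of the gyrogroup $(G(n),\oplus)$ described in the context. Then $Int(P(G(n)))=C(P(G(n)))$ (the interior equals the subgraph induced by the center) and $Cl(P(G(n)))=P(G(n))$.
   Context: Let $n\ge 3$ and $m=2^{n-1}$. Put $P(n)=\{0,1,\dots,m-1\}$, $H(n)=\{m,m+1,\dots,2^n-1\}$ and $G(n)=P(n)\cup H(n)$. Define a binary operation $\oplus$ on $G(n)$ by: $i\oplus j=t$ if $(i,j)\in P(n)\times P(n)$; $i\oplus j=t+m$ if $(i,j)\in P(n)\times H(n)$; $i\oplus j=s+m$ if $(i,j)\in H(n)\times P(n)$; $i\oplus j=k$ if $(i,j)\in H(n)\times H(n)$, where $t,s,k\in P(n)$ are determined by $t\equiv i+j$, $s\equiv i+(\tfrac m2-1)j$, $k\equiv(\tfrac m2+1)i+(\tfrac m2-1)j \pmod m$. Then $(G(n),\oplus)$ is a gyrogroup with identity $e=0$. Powers are defined by $a^1=a$, $a^{k+1}=a\oplus a^k$. The power graph $P(G(n))$ is the simple undirected graph with vertex set $G(n)$ in which two distinct vertices $u,v$ are adjacent if and only if $u^k=v$ or $v^k=u$ for some positive integer $k$. In a connected graph $G$ with distance $d$: a vertex $v$ is an interior vertex if for every vertex $u\ne v$ there is a vertex $w$ with $d(u,w)=d(u,v)+d(v,w)$; the interior $Int(G)$ is the subgraph induced by the interior vertices. The center $C(G)$ is the subgraph induced by the vertices of minimum eccentricity. The closure $Cl(G)$ of a graph of order $N$ is obtained by repeatedly adding edges between non-adjacent vertices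 whose degree sum is at least $N$ until no such pair remains. -}

module Defs where

open import Level using (0ℓ)
open import Data.Nat using (ℕ; zero; suc; _+_; _*_; _∸_; _^_; _≤_; _<_; _<ᵇ_; NonZero)
open import Data.Nat.Properties using (m^n≢0)
open import Data.Nat.DivMod using (_%_)
open import Data.Bool using (if_then_else_)
open import Data.Fin using (Fin; toℕ)
open import Data.List using (List; length)
open import Data.List.Membership.Propositional using (_∈_)
open import Data.List.Relation.Unary.Unique.Propositional using (Unique)
open import Data.Product using (Σ; ∃; ∃-syntax; _×_; _,_)
open import Data.Sum using (_⊎_)
open import Relation.Nullary using (¬_)
open import Relation.Binary.PropositionalEquality using (_≡_; _≢_)
open import Function.Bundles using (_⇔_)

half : ℕ → ℕ
half n = 2 ^ (n ∸ 1)

modm : ℕ → ℕ → ℕ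
modm n x = _%_ x (2 ^ (n ∸ 1)) {{m^n≢0 2 (n ∸ 1)}}

-- membership in P(n) = {0,…,m-1} (as a boolean test i < m)
-- the operation ⊕ on G(n)
gyroOp : ℕ → ℕ → ℕ → ℕ
gyroOp n i j =
  if i <ᵇ m
  then (if j <ᵇ m
        then modm n (i + j)
        else modm n (i + j) + m)
  else (if j <ᵇ m
        then modm n (i + (m2 ∸ 1) * j) + m
        else modm n ((m2 + 1) * i + (m2 ∸ 1) * j))
  where
    m : ℕ
    m = half n
    m2 : ℕ
    m2 = 2 ^ (n ∸ 2)

-- powS n a k = a^(k+1) :  a^1 = a,  a^(k+1) = a ⊕ a^k
powS : ℕ → ℕ → ℕ → ℕ
powS n a zero    = a
powS n a (suc k) = gyroOp n a (powS n a k)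

Vtx : ℕ → Set
Vtx n = Fin (2 ^ n)

IsPowerOf : (n : ℕ) → Vtx n → Vtx n → Set
IsPowerOf n u v = ∃[ k ] (powS n (toℕ u) k ≡ toℕ v)

PowerAdj : (n : ℕ) → Vtx n → Vtx n → Set
PowerAdj n u v = u ≢ v × (IsPowerOf n u v ⊎ IsPowerOf n v u)

Graph : ℕ → Set₁
Graph N = Fin N → Fin N → Set

module GraphNotions {N : ℕ} (adj : Graph N) where

  data Walk : Fin N → Fin N → ℕ → Set where
    here  : ∀ {u} → Walk u u 0
    there : ∀ {u w v L} → adj u w → Walk w v L → Walk u v (suc L)

  Dist : Fin N → Fin N → ℕ → Set
  Dist u v d = Walk u v d × (∀ L → Walk u v L → d ≤ L)

  Interior : Fin N → Set
  Interior v = ∀ u → u ≢ v →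
    ∃[ w ] ∃[ d₁ ] ∃[ d₂ ] (w ≢ v × Dist u v d₁ × Dist v w d₂ × Dist u w (d₁ + d₂))

  Ecc : Fin N → ℕ → Set
  Ecc v e = (∀ u d → Dist v u d → d ≤ e) × (∃[ u ] Dist v u e)

  Central : Fin N → Set
  Central v = ∃[ e ] (Ecc v e × (∀ w e' → Ecc w e' → e ≤ e'))

  Deg : Fin N → ℕ → Set
  Deg v d = ∃[ ls ] (Unique ls × (∀ w → (w ∈ ls) ⇔ adj v w) × length ls ≡ d)

addEdge : ∀ {N} → Graph N → Fin N → Fin N → Graph N
addEdge H a b x y = H x y ⊎ ((x ≡ a × y ≡ b) ⊎ (x ≡ b × y ≡ a))

data ClosureFrom {N : ℕ} : Graph N → Graph N → Set₁ where
  done : ∀ {H} →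
         (∀ u v → u ≢ v → ¬ H u v → ∀ du dv →
            GraphNotions.Deg H u du → GraphNotions.Deg H v dv → du + dv < N) →
         ClosureFrom H H
  step : ∀ {H K} u v du dv → u ≢ v → ¬ H u v →
         GraphNotions.Deg H u du → GraphNotions.Deg H v dv → N ≤ du + dv →
         ClosureFrom (addEdge H u v) K → ClosureFrom H K

-- In G(n) the elements of P(n) form the cyclic group ℤ_m, while every h ∈ H(n) satisfies
-- h ⊕ h = 0 and h ⊕ 0 = h, so the powers of h alternate between h and 0. Hence 0 is adjacent
-- to every other vertex, an element of H(n) is adjacent to 0 only, and a non-zero element of
-- P(n) only to elements of P(n). So 0 is the unique dominating vertex, and in such a graph
-- both the interior and the center are {0}: every other vertex has eccentricity 2 and lies
-- on no geodesic starting at 0. Two distinct non-adjacent vertices are non-zero, so each has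
-- degree at most m - 1 and their degree sum is below 2m = |G(n)|: the closure adds no edge.
module Submission where

open import Defs
open import Data.Nat using (ℕ; _≤_)
open import Data.Product using (_×_; ∃-syntax)
open import Function.Bundles using (_⇔_)

open import Data.Nat
  using (zero; suc; _+_; _*_; _∸_; _^_; _<_; _<ᵇ_; NonZero; z≤n; s≤s; pred)
open import Data.Nat.Properties
open import Data.Nat.DivMod
  using (_%_; m%n<n; m<n⇒m%n≡m; m*n%n≡0; [m+n]%n≡m%n; %-distribˡ-+; m%n%n≡m%n)
open import Data.Bool using (true; false; T)
open import Data.Unit using (tt)
open import Data.Fin using (Fin; toℕ; fromℕ<; inject≤)
import Data.Fin as Fin
open import Data.Fin.Properties
  using (toℕ-injective; toℕ-fromℕ<; toℕ-inject≤; toℕ<n; injective⇒≤)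
  renaming (_≟_ to _≟ᶠ_)
open import Data.List using (List; []; _∷_; length; lookup; tabulate)
open import Data.List.Properties using (length-tabulate)
open import Data.List.Membership.Propositional using (_∈_)
open import Data.List.Membership.Propositional.Properties using (∈-lookup; ∈-tabulate⁺)
open import Data.List.Membership.Setoid.Properties using (index-injective)
open import Data.List.Relation.Binary.Subset.Propositional using (_⊆_)
open import Data.List.Relation.Unary.Any using (here; there; index)
import Data.List.Relation.Unary.All as All
open import Data.List.Relation.Unary.AllPairs using (_∷_)
open import Data.List.Relation.Unary.Unique.Propositional using (Unique)
open import Data.Product using (_,_; proj₁)
open import Data.Sum using (_⊎_; inj₁; inj₂; swap)
open import Relation.Nullary using (¬_; yes; no; contradiction)
open import Relation.Binary.PropositionalEquality
open import Function.Base using (_∘_)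
open import Function.Definitions using (Injective)
open import Function.Bundles using (mk⇔; Equivalence)
open import Function.Construct.Composition using (_⇔-∘_)
open import Function.Construct.Symmetry using (⇔-sym)

module _ {a} {A : Set a} where

  Unique⇒lookup-injective : {xs : List A} → Unique xs → Injective _≡_ _≡_ (lookup xs)
  Unique⇒lookup-injective (_ ∷ _)   {Fin.zero}  {Fin.zero}  _  = refl
  Unique⇒lookup-injective (x∉ ∷ _)  {Fin.zero}  {Fin.suc j} eq =
    contradiction eq (All.lookup x∉ (∈-lookup j))
  Unique⇒lookup-injective (x∉ ∷ _)  {Fin.suc i} {Fin.zero}  eq =
    contradiction (sym eq) (All.lookup x∉ (∈-lookup i))
  Unique⇒lookup-injective (_ ∷ xs!) {Fin.suc i} {Fin.suc j} eq =
    cong Fin.suc (Unique⇒lookup-injective xs! eq)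

  Unique∧⊆⇒length≤ : {xs ys : List A} →
                     Unique xs → xs ⊆ ys → length xs ≤ length ys
  Unique∧⊆⇒length≤ {xs} {ys} xs! xs⊆ys = injective⇒≤ position-injective
    where
      position : Fin (length xs) → Fin (length ys)
      position i = index (xs⊆ys (∈-lookup i))

      position-injective : Injective _≡_ _≡_ position
      position-injective {i} {j} eq = Unique⇒lookup-injective xs!
        (index-injective (setoid A) (xs⊆ys (∈-lookup i)) (xs⊆ys (∈-lookup j)) eq)

module SimpleGraph {N : ℕ} (adj : Graph N)
                   (adj⇒≢ : ∀ {u v} → adj u v → u ≢ v)
                   (adj-sym : ∀ {u v} → adj u v → adj v u) where

  open GraphNotions adj

  walk₀⇒≡ : ∀ {u v} → Walk u v 0 → u ≡ v
  walk₀⇒≡ here = refl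

  walk₁⇒adj : ∀ {u v} → Walk u v 1 → adj u v
  walk₁⇒adj (there uv here) = uv

  Dist-functional : ∀ {u v d d′} → Dist u v d → Dist u v d′ → d ≡ d′
  Dist-functional (walk , minimal) (walk′ , minimal′) =
    ≤-antisym (minimal _ walk′) (minimal′ _ walk)

  Dist-pos : ∀ {u v d} → u ≢ v → Dist u v d → 1 ≤ d
  Dist-pos {d = zero}  u≢v (walk , _) = contradiction (walk₀⇒≡ walk) u≢v
  Dist-pos {d = suc _} _   _          = s≤s z≤n

  adj⇒Dist₁ : ∀ {u v} → adj u v → Dist u v 1
  adj⇒Dist₁ {u} {v} uv = there uv here , minimal
    where
      minimal : ∀ L → Walk u v L → 1 ≤ L
      minimal zero    walk = contradiction (walk₀⇒≡ walk) (adj⇒≢ uv)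
      minimal (suc _) _    = s≤s z≤n

  nonadj⇒Dist₂ : ∀ {u v w} → u ≢ v → ¬ adj u v → adj u w → adj w v → Dist u v 2
  nonadj⇒Dist₂ {u} {v} u≢v ¬uv uw wv = there uw (there wv here) , minimal
    where
      minimal : ∀ L → Walk u v L → 2 ≤ L
      minimal zero          walk = contradiction (walk₀⇒≡ walk) u≢v
      minimal (suc zero)    walk = contradiction (walk₁⇒adj walk) ¬uv
      minimal (suc (suc _)) _    = s≤s (s≤s z≤n)

  suc-degree≤ : ∀ {v d} (ys : List (Fin N)) →
                v ∈ ys → (∀ {w} → adj v w → w ∈ ys) → Deg v d → suc d ≤ length ys
  suc-degree≤ {v} ys v∈ys nbrs∈ys (ls , ls! , ls-nbrs , refl) =
    Unique∧⊆⇒length≤ (All.tabulate (adj⇒≢ ∘ nbr) ∷ ls!) v∷ls⊆ys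
    where
      nbr : ∀ {w} → w ∈ ls → adj v w
      nbr {w} = Equivalence.to (ls-nbrs w)

      v∷ls⊆ys : (v ∷ ls) ⊆ ys
      v∷ls⊆ys (here refl)  = v∈ys
      v∷ls⊆ys (there w∈ls) = nbrs∈ys (nbr w∈ls)

  module UniqueDominatingVertex
    (z : Fin N) (z-dominating : ∀ {u} → u ≢ z → adj z u)
    (others-not-dominating : ∀ {v} → v ≢ z → ∃[ w ] (v ≢ w × ¬ adj v w))
    (v₀ : Fin N) (v₀≢z : v₀ ≢ z) where

    Dist-from-z≤1 : ∀ {w d} → Dist z w d → d ≤ 1
    Dist-from-z≤1 {w} (_ , minimal) with w ≟ᶠ z
    ... | yes refl = ≤-trans (minimal 0 here) z≤n
    ... | no w≢z   = minimal 1 (there (z-dominating w≢z) here)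

    has-neighbour : ∀ w → ∃[ u ] adj w u
    has-neighbour w with w ≟ᶠ z
    ... | yes refl = v₀ , z-dominating v₀≢z
    ... | no w≢z   = z , adj-sym (z-dominating w≢z)

    distant-vertex : ∀ {v} → v ≢ z → ∃[ w ] (w ≢ z × Dist v w 2)
    distant-vertex {v} v≢z with others-not-dominating v≢z
    ... | w , v≢w , ¬vw =
      w , w≢z , nonadj⇒Dist₂ v≢w ¬vw (adj-sym (z-dominating v≢z)) (z-dominating w≢z)
      where
        w≢z : w ≢ z
        w≢z refl = ¬vw (adj-sym (z-dominating v≢z))

    Ecc-z : Ecc z 1
    Ecc-z = (λ _ _ → Dist-from-z≤1) , v₀ , adj⇒Dist₁ (z-dominating v₀≢z)

    Ecc-pos : ∀ {w e} → Ecc w e → 1 ≤ e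
    Ecc-pos {w} (bound , _) with has-neighbour w
    ... | u , wu = bound u 1 (adj⇒Dist₁ wu)

    central⇔≡z : ∀ v → Central v ⇔ v ≡ z
    central⇔≡z v = mk⇔ central⇒≡z (λ { refl → 1 , Ecc-z , λ _ _ → Ecc-pos })
      where
        central⇒≡z : Central v → v ≡ z
        central⇒≡z (e , (bound , _) , minimal) with v ≟ᶠ z
        ... | yes v≡z = v≡z
        ... | no v≢z with distant-vertex v≢z
        ...   | w , _ , Dvw =
          contradiction (≤-trans (bound w 2 Dvw) (minimal z 1 Ecc-z)) (λ { (s≤s ()) })

    interior⇔≡z : ∀ v → Interior v ⇔ v ≡ z
    interior⇔≡z v = mk⇔ interior⇒≡z λ { refl → z-interior }
      where
        z-interior : Interior z
        z-interior u u≢z with distant-vertex u≢z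
        ... | w , w≢z , Duw =
          w , 1 , 1 , w≢z , adj⇒Dist₁ (adj-sym (z-dominating u≢z))
                          , adj⇒Dist₁ (z-dominating w≢z) , Duw

        interior⇒≡z : Interior v → v ≡ z
        interior⇒≡z int with v ≟ᶠ z
        ... | yes v≡z = v≡z
        ... | no v≢z with int z (λ z≡v → v≢z (sym z≡v))
        ...   | w , d₁ , d₂ , w≢v , Dzv , Dvw , Dzw =
          contradiction (Dist-from-z≤1 Dzw) (<⇒≱ 1<d₁+d₂)
          where
            1<d₁+d₂ : 1 < d₁ + d₂
            1<d₁+d₂ rewrite Dist-functional Dzv (adj⇒Dist₁ (z-dominating v≢z)) =
              s≤s (Dist-pos (λ v≡w → w≢v (sym v≡w)) Dvw)

    interior⇔central : ∀ v → Interior v ⇔ Central v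
    interior⇔central v = ⇔-sym (central⇔≡z v) ⇔-∘ interior⇔≡z v

module _ {N : ℕ} (H : Graph N) where

  open GraphNotions H

  ClosureStable : Set
  ClosureStable =
    ∀ u v → u ≢ v → ¬ H u v → ∀ du dv → Deg u du → Deg v dv → du + dv < N

  ClosureFrom-stable : ClosureStable → ∀ {K} → ClosureFrom H K → ∀ u v → K u v ⇔ H u v
  ClosureFrom-stable _      (done _) _ _ = mk⇔ (λ uv → uv) (λ uv → uv)
  ClosureFrom-stable stable (step u v du dv u≢v ¬uv Du Dv N≤du+dv _) _ _ =
    contradiction N≤du+dv (<⇒≱ (stable u v u≢v ¬uv du dv Du Dv))

<ᵇ-true : ∀ {i k} → i < k → (i <ᵇ k) ≡ true
<ᵇ-true {i} {k} i<k with i <ᵇ k in eq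
... | true  = refl
... | false = contradiction (subst T eq (<⇒<ᵇ i<k)) (λ ())

<ᵇ-false : ∀ {i k} → k ≤ i → (i <ᵇ k) ≡ false
<ᵇ-false {i} {k} k≤i with i <ᵇ k in eq
... | true  = contradiction k≤i (<⇒≱ (<ᵇ⇒< i k (subst T (sym eq) tt)))
... | false = refl

-- n = j + 2: the argument only needs m/2 ≥ 1.
module PowerGraph (j : ℕ) where

  n : ℕ
  n = suc (suc j)

  m : ℕ
  m = half n

  m/2 : ℕ
  m/2 = 2 ^ j

  instance
    m≢0 : NonZero m
    m≢0 = m^n≢0 2 (suc j)

  m≡m/2+m/2 : m ≡ m/2 + m/2
  m≡m/2+m/2 = cong (m/2 +_) (+-identityʳ m/2)

  2ⁿ≡m+m : 2 ^ n ≡ m + m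
  2ⁿ≡m+m = cong (m +_) (+-identityʳ m)

  0<m : 0 < m
  0<m = m^n>0 2 (suc j)

  2≤m : 2 ≤ m
  2≤m = *-monoʳ-≤ 2 (m^n>0 2 j)

  m<2ⁿ : m < 2 ^ n
  m<2ⁿ = subst (m <_) (sym 2ⁿ≡m+m) (m<m+n m 0<m)

  m≤2ⁿ : m ≤ 2 ^ n
  m≤2ⁿ = <⇒≤ m<2ⁿ

  ⊕-PP : ∀ {i k} → i < m → k < m → gyroOp n i k ≡ (i + k) % m
  ⊕-PP {i} {k} i<m k<m rewrite <ᵇ-true i<m | <ᵇ-true k<m = refl

  ⊕-HP : ∀ {i k} → m ≤ i → k < m → gyroOp n i k ≡ (i + (m/2 ∸ 1) * k) % m + m
  ⊕-HP {i} {k} m≤i k<m rewrite <ᵇ-false m≤i | <ᵇ-true k<m = refl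

  ⊕-HH : ∀ {i k} → m ≤ i → m ≤ k →
         gyroOp n i k ≡ ((m/2 + 1) * i + (m/2 ∸ 1) * k) % m
  ⊕-HH {i} {k} m≤i m≤k rewrite <ᵇ-false m≤i | <ᵇ-false m≤k = refl

  h⊕0≡h : ∀ {h} → m ≤ h → h < 2 ^ n → gyroOp n h 0 ≡ h
  h⊕0≡h {h} m≤h h<2ⁿ = begin
    gyroOp n h 0                    ≡⟨ ⊕-HP m≤h 0<m ⟩
    (h + (m/2 ∸ 1) * 0) % m + m     ≡⟨ cong (λ x → (h + x) % m + m) (*-zeroʳ (m/2 ∸ 1)) ⟩
    (h + 0) % m + m                 ≡⟨ cong (λ x → x % m + m) (+-identityʳ h) ⟩
    h % m + m                       ≡⟨ cong (λ x → x % m + m) (sym (m∸n+n≡m m≤h)) ⟩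
    ((h ∸ m) + m) % m + m           ≡⟨ cong (_+ m) ([m+n]%n≡m%n (h ∸ m) m) ⟩
    (h ∸ m) % m + m                 ≡⟨ cong (_+ m) (m<n⇒m%n≡m h∸m<m) ⟩
    (h ∸ m) + m                     ≡⟨ m∸n+n≡m m≤h ⟩
    h                               ∎
    where
      open ≡-Reasoning
      h∸m<m : h ∸ m < m
      h∸m<m = +-cancelʳ-< m (h ∸ m) m
        (subst (_< m + m) (sym (m∸n+n≡m m≤h)) (subst (h <_) 2ⁿ≡m+m h<2ⁿ))

  h⊕h≡0 : ∀ {h} → m ≤ h → gyroOp n h h ≡ 0
  h⊕h≡0 {h} m≤h = begin
    gyroOp n h h                          ≡⟨ ⊕-HH m≤h m≤h ⟩
    ((m/2 + 1) * h + (m/2 ∸ 1) * h) % m   ≡⟨ cong (_% m) (sym (*-distribʳ-+ h (m/2 + 1) _)) ⟩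
    ((m/2 + 1 + (m/2 ∸ 1)) * h) % m       ≡⟨ cong (λ x → (x * h) % m) coefficient≡m ⟩
    (m * h) % m                           ≡⟨ cong (_% m) (*-comm m h) ⟩
    (h * m) % m                           ≡⟨ m*n%n≡0 h m ⟩
    0                                     ∎
    where
      open ≡-Reasoning
      coefficient≡m : m/2 + 1 + (m/2 ∸ 1) ≡ m
      coefficient≡m = begin
        m/2 + 1 + (m/2 ∸ 1)   ≡⟨ +-assoc m/2 1 (m/2 ∸ 1) ⟩
        m/2 + (1 + (m/2 ∸ 1)) ≡⟨ cong (m/2 +_) (m+[n∸m]≡n (m^n>0 2 j)) ⟩
        m/2 + m/2             ≡⟨ sym m≡m/2+m/2 ⟩
        m                     ∎

  powS-H : ∀ {h} k → m ≤ h → h < 2 ^ n → powS n h k ≡ h ⊎ powS n h k ≡ 0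
  powS-H zero    _   _    = inj₁ refl
  powS-H {h} (suc k) m≤h h<2ⁿ with powS-H k m≤h h<2ⁿ
  ... | inj₁ hᵏ≡h = inj₂ (trans (cong (gyroOp n h) hᵏ≡h) (h⊕h≡0 m≤h))
  ... | inj₂ hᵏ≡0 = inj₁ (trans (cong (gyroOp n h) hᵏ≡0) (h⊕0≡h m≤h h<2ⁿ))

  powS-P : ∀ {p} k → p < m → powS n p k ≡ (suc k * p) % m
  powS-P {p} zero    p<m = sym (trans (cong (_% m) (+-identityʳ p)) (m<n⇒m%n≡m p<m))
  powS-P {p} (suc k) p<m = begin
    gyroOp n p (powS n p k)                 ≡⟨ cong (gyroOp n p) (powS-P k p<m) ⟩
    gyroOp n p ((suc k * p) % m)            ≡⟨ ⊕-PP p<m (m%n<n _ m) ⟩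
    (p + (suc k * p) % m) % m               ≡⟨ %-distribˡ-+ p _ m ⟩
    (p % m + (suc k * p) % m % m) % m       ≡⟨ cong (λ x → (p % m + x) % m) (m%n%n≡m%n _ m) ⟩
    (p % m + (suc k * p) % m) % m           ≡⟨ sym (%-distribˡ-+ p (suc k * p) m) ⟩
    (suc (suc k) * p) % m                   ∎
    where open ≡-Reasoning

  powS-P<m : ∀ {p} k → p < m → powS n p k < m
  powS-P<m k p<m = subst (_< m) (sym (powS-P k p<m)) (m%n<n _ m)

  powS-P-order : ∀ {p} → p < m → powS n p (pred m) ≡ 0
  powS-P-order {p} p<m = begin
    powS n p (pred m)       ≡⟨ powS-P (pred m) p<m ⟩
    (suc (pred m) * p) % m  ≡⟨ cong (λ x → (x * p) % m) (suc-pred m) ⟩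
    (m * p) % m             ≡⟨ cong (_% m) (*-comm m p) ⟩
    (p * m) % m             ≡⟨ m*n%n≡0 p m ⟩
    0                       ∎
    where open ≡-Reasoning

  ε : Vtx n
  ε = fromℕ< (≤-trans 0<m m≤2ⁿ)

  toℕ-ε : toℕ ε ≡ 0
  toℕ-ε = toℕ-fromℕ< _

  mid : Vtx n
  mid = fromℕ< m<2ⁿ

  m≤mid : m ≤ toℕ mid
  m≤mid = ≤-reflexive (sym (toℕ-fromℕ< m<2ⁿ))

  one : Vtx n
  one = fromℕ< (≤-trans 2≤m m≤2ⁿ)

  toℕ-one : toℕ one ≡ 1
  toℕ-one = toℕ-fromℕ< _

  ≡ε : ∀ {v} → toℕ v ≡ 0 → v ≡ ε
  ≡ε v≡0 = toℕ-injective (trans v≡0 (sym toℕ-ε))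

  IsPowerOf-ε : ∀ u → IsPowerOf n u ε
  IsPowerOf-ε u with toℕ u <? m
  ... | yes u<m = pred m , trans (powS-P-order u<m) (sym toℕ-ε)
  ... | no u≮m  = 1 , trans (h⊕h≡0 (≮⇒≥ u≮m)) (sym toℕ-ε)

  IsPowerOf-P : ∀ {p u} → toℕ p < m → IsPowerOf n p u → toℕ u < m
  IsPowerOf-P p<m (k , pᵏ≡u) = subst (_< m) pᵏ≡u (powS-P<m k p<m)

  IsPowerOf-H : ∀ {h u} → m ≤ toℕ h → IsPowerOf n h u → u ≡ h ⊎ u ≡ ε
  IsPowerOf-H {h} m≤h (k , hᵏ≡u) with powS-H k m≤h (toℕ<n h)
  ... | inj₁ hᵏ≡h = inj₁ (toℕ-injective (trans (sym hᵏ≡u) hᵏ≡h))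
  ... | inj₂ hᵏ≡0 = inj₂ (≡ε (trans (sym hᵏ≡u) hᵏ≡0))

  one≢ε : one ≢ ε
  one≢ε one≡ε with trans (sym toℕ-one) (trans (cong toℕ one≡ε) toℕ-ε)
  ... | ()

  H∌ε : ∀ {h} → m ≤ toℕ h → h ≢ ε
  H∌ε m≤h refl = <⇒≱ 0<m (subst (m ≤_) toℕ-ε m≤h)

  PowerAdj-sym : ∀ {u v} → PowerAdj n u v → PowerAdj n v u
  PowerAdj-sym (u≢v , powers) = ≢-sym u≢v , swap powers

  ε-dominating : ∀ {u} → u ≢ ε → PowerAdj n ε u
  ε-dominating u≢ε = ≢-sym u≢ε , inj₂ (IsPowerOf-ε _)

  H-neighbour≡ε : ∀ {h u} → m ≤ toℕ h → PowerAdj n h u → u ≡ ε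
  H-neighbour≡ε m≤h (h≢u , inj₁ h→u) with IsPowerOf-H m≤h h→u
  ... | inj₁ u≡h = contradiction (sym u≡h) h≢u
  ... | inj₂ u≡ε = u≡ε
  H-neighbour≡ε {u = u} m≤h (h≢u , inj₂ u→h) with toℕ u <? m
  ... | yes u<m = contradiction m≤h (<⇒≱ (IsPowerOf-P u<m u→h))
  ... | no u≮m with IsPowerOf-H (≮⇒≥ u≮m) u→h
  ...   | inj₁ h≡u = contradiction h≡u h≢u
  ...   | inj₂ h≡ε = contradiction h≡ε (H∌ε m≤h)

  P-neighbour<m : ∀ {p w} → p ≢ ε → PowerAdj n p w → toℕ w < m
  P-neighbour<m {w = w} p≢ε pw with toℕ w <? m
  ... | yes w<m = w<m
  ... | no w≮m  = contradiction (H-neighbour≡ε (≮⇒≥ w≮m) (PowerAdj-sym pw)) p≢ε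

  others-not-dominating : ∀ {v} → v ≢ ε → ∃[ w ] (v ≢ w × ¬ PowerAdj n v w)
  others-not-dominating {v} v≢ε with toℕ v <? m
  ... | yes v<m = mid , (λ { refl → <⇒≱ v<m m≤mid })
                     , λ v-mid → v≢ε (H-neighbour≡ε m≤mid (PowerAdj-sym v-mid))
  ... | no v≮m  = one , (λ { refl → v≮m (subst (_< m) (sym toℕ-one) 2≤m) })
                     , λ v-one → one≢ε (H-neighbour≡ε (≮⇒≥ v≮m) v-one)

  open SimpleGraph (PowerAdj n) proj₁ PowerAdj-sym
  open GraphNotions (PowerAdj n) using (Deg)

  P-vertices : List (Vtx n)
  P-vertices = tabulate {n = m} (λ i → inject≤ i m≤2ⁿ)

  ∈-P-vertices : ∀ {v} → toℕ v < m → v ∈ P-vertices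
  ∈-P-vertices {v} v<m = subst (_∈ P-vertices) v′≡v (∈-tabulate⁺ (fromℕ< v<m))
    where
      v′≡v : inject≤ (fromℕ< v<m) m≤2ⁿ ≡ v
      v′≡v = toℕ-injective (trans (toℕ-inject≤ _ m≤2ⁿ) (toℕ-fromℕ< v<m))

  degree<m : ∀ {v d} → v ≢ ε → Deg v d → d < m
  degree<m {v} v≢ε Dv with toℕ v <? m
  ... | yes v<m = subst (_ ≤_) (length-tabulate _)
                    (suc-degree≤ P-vertices (∈-P-vertices v<m)
                                 (∈-P-vertices ∘ P-neighbour<m v≢ε) Dv)
  ... | no v≮m  = ≤-trans (suc-degree≤ (v ∷ ε ∷ []) (here refl)
                    (λ vw → there (here (H-neighbour≡ε (≮⇒≥ v≮m) vw))) Dv) 2≤m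

  closureStable : ClosureStable (PowerAdj n)
  closureStable u v u≢v ¬uv du dv Du Dv =
    subst (du + dv <_) (sym 2ⁿ≡m+m)
      (+-mono-< (degree<m (nonadjacent≢ε u≢v ¬uv) Du)
                (degree<m (nonadjacent≢ε (≢-sym u≢v) (¬uv ∘ PowerAdj-sym)) Dv))
    where
      nonadjacent≢ε : ∀ {x y} → x ≢ y → ¬ PowerAdj n x y → x ≢ ε
      nonadjacent≢ε x≢y ¬xy refl = ¬xy (ε-dominating (≢-sym x≢y))

  open UniqueDominatingVertex ε ε-dominating others-not-dominating one one≢ε public

mainTheorem12 : (n : ℕ) → 3 ≤ n →
    (∀ v → GraphNotions.Interior (PowerAdj n) v ⇔ GraphNotions.Central (PowerAdj n) v)
    × (∃[ K ] ClosureFrom (PowerAdj n) K)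
    × (∀ K → ClosureFrom (PowerAdj n) K → ∀ u v → K u v ⇔ PowerAdj n u v)
mainTheorem12 (suc (suc j)) (s≤s (s≤s _)) =
    interior⇔central
  , (PowerAdj n , done closureStable)
  , λ _ → ClosureFrom-stable (PowerAdj n) closureStable
  where open PowerGraph j
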